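{- Let $\phi$ be an MTL formula, $\pi$ a lasso trace, and $a\in\mathbb{N}$. If $\pi,t\vDash\phi$ for all $t\in[a,\mathrm{end}_\pi(a)]$, then $\pi,t'\vDash\phi$ for all $t'\in\mathbb{N}$ with $t'\ge a$.
   Context: MTL formulae over propositions $\mathcal{P}$: $\phi ::= p \mid \top \mid \neg\phi \mid \phi\land\phi \mid \phi\,\mathcal{U}_I\,\phi \mid \phi\,\mathcal{R}_I\,\phi$, with intervals $I=[a,b]$, $a\in\mathbb{N}$, $b\in\mathbb{N}\cup\{\infty\}$, $a\le b$. Traces are infinite sequences of subsets of $\mathcal{P}$, with pointwise semantics: $\pi,t\vDash p$ iff $p\in\pi(t)$; $\neg,\land,\top$ as usual; $\pi,t\vDash\phi_1\,\mathcal{U}_I\,\phi_2$ iff there is $i\in I$ with $\pi,t+i\vDash\phi_2$ and $\pi,t+j\vDash\phi_1$ for all $j\in[0,i)\cap I$; $\phi_1\,\mathcal{R}_I\,\phi_2$ means $\neg(\neg\phi_1\,\mathcal{U}_I\,\neg\phi_2)$. A trace $\pi$ is a lasso trace if $\pi=\pi_{\mathrm{pre}}(\pi_{\mathrm{suf}})^\omega$ for a finite prefix $\pi_{\mathrm{pre}}$ and a nonempty finite word $\pi_{\mathrm{suf}}$ repeated infinitely, both chosen minimal; $|\pi|:=|\pi_{\mathrm{pre}}|+|\pi_{\mathrm{suf}}|$. For $a\in\mathbb{N}$, $\mathrm{end}_\pi(a)=|\pi|$ if $a<|\pi_{\mathrm{pre}}|$, and $\mathrm{end}_\pi(a)=a+|\pi_{\mathrm{suf}}|-1$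 otherwise; $[a,\mathrm{end}_\pi(a)]$ denotes the set of naturals between these bounds inclusive. -}

module Defs where

open import Data.Nat using (ℕ; zero; suc; _+_; _∸_; _≤_; _<_; _≥_)
open import Data.Bool using (Bool; true)
open import Data.List using (List; []; _∷_; length; lookup)
open import Data.Fin using (fromℕ<)
open import Data.Nat.DivMod using (_%_; m%n<n)
open import Data.Nat.Base using (NonZero)
open import Data.Product using (Σ; ∃; _×_; _,_)
open import Data.Empty using (⊥)
open import Data.Unit using (⊤)
open import Relation.Nullary using (¬_)
open import Relation.Binary.PropositionalEquality using (_≡_)

data Bound : Set where
  fin : ℕ → Bound
  ∞   : Bound

_≤B_ : ℕ → Bound → Set
a ≤B fin b = a ≤ b
a ≤B ∞     = ⊤

record Interval : Set where
  constructor [_,_]⟨_⟩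
  field
    lo    : ℕ
    hi    : Bound
    lo≤hi : lo ≤B hi
open Interval public

_∈I_ : ℕ → Interval → Set
i ∈I I = (lo I ≤ i) × (i ≤B hi I)

data MTL (P : Set) : Set where
  atom : P → MTL P
  ⊤ᶠ   : MTL P
  ¬ᶠ_  : MTL P → MTL P
  _∧ᶠ_ : MTL P → MTL P → MTL P
  _𝒰⟨_⟩_ : MTL P → Interval → MTL P → MTL P
  _ℛ⟨_⟩_ : MTL P → Interval → MTL P → MTL P

-- A letter is a subset of P (characteristic function); a trace is an
-- infinite sequence of letters.
Letter : Set → Set
Letter P = P → Bool

Trace : Set → Set
Trace P = ℕ → Letter P

Until : (ℕ → Set) → Interval → (ℕ → Set) → ℕ → Set
Until S₁ I S₂ t =
  Σ ℕ λ i → (i ∈I I) × S₂ (t + i) ×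
    ((j : ℕ) → j < i → j ∈I I → S₁ (t + j))

_,_⊨_ : {P : Set} → Trace P → ℕ → MTL P → Set
π , t ⊨ atom p = π t p ≡ true
π , t ⊨ ⊤ᶠ = ⊤
π , t ⊨ (¬ᶠ φ) = ¬ (π , t ⊨ φ)
π , t ⊨ (φ ∧ᶠ ψ) = (π , t ⊨ φ) × (π , t ⊨ ψ)
π , t ⊨ (φ 𝒰⟨ I ⟩ ψ) = Until (λ s → π , s ⊨ φ) I (λ s → π , s ⊨ ψ) t
π , t ⊨ (φ ℛ⟨ I ⟩ ψ) =
  ¬ Until (λ s → ¬ (π , s ⊨ φ)) I (λ s → ¬ (π , s ⊨ ψ)) t

-- A lasso presentation π_pre (π_suf)^ω with π_suf nonempty.
record Lasso (P : Set) : Set where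
  constructor lasso
  field
    pre : List (Letter P)
    suf : List (Letter P)
    suf-nonempty : 0 < length suf
open Lasso public

⟦_⟧ : {P : Set} → Lasso P → Trace P
⟦ lasso pre suf ne ⟧ t with t Data.Nat.<? length pre
  where open import Data.Nat using (_<?_)
... | Relation.Nullary.yes t<n = lookup pre (fromℕ< t<n)
... | Relation.Nullary.no _ =
  lookup suf (fromℕ< (m%n<n (t ∸ length pre) (length suf) {{nz ne}}))
  where
  nz : ∀ {n} → 0 < n → NonZero n
  nz {suc n} _ = _

_≈ᵗ_ : {P : Set} → Trace P → Trace P → Set
π ≈ᵗ π' = ∀ t p → π t p ≡ π' t p

record MinimalLassoOf {P : Set} (π : Trace P) (L : Lasso P) : Set where
  field
    presents : ⟦ L ⟧ ≈ᵗ π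
    pre-min  : ∀ (L' : Lasso P) → ⟦ L' ⟧ ≈ᵗ π → length (pre L) ≤ length (pre L')
    suf-min  : ∀ (L' : Lasso P) → ⟦ L' ⟧ ≈ᵗ π → length (suf L) ≤ length (suf L')

∣_∣ˡ : {P : Set} → Lasso P → ℕ
∣ L ∣ˡ = length (pre L) + length (suf L)

end : {P : Set} → Lasso P → ℕ → ℕ
end L a with a Data.Nat.<? length (pre L)
  where open import Data.Nat using (_<?_)
... | Relation.Nullary.yes _ = ∣ L ∣ˡ
... | Relation.Nullary.no _  = a + length (suf L) ∸ 1

{-# OPTIONS --safe #-}
-- Satisfaction of an MTL formula at t depends only on the suffix of the trace
-- from t.  Beyond its prefix a lasso trace is periodic with period |π_suf|, so
-- satisfaction propagates from t to t + |π_suf|.  The window [a, end_π(a)]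
-- always contains |π_suf| consecutive positions at or after max(a, |π_pre|),
-- and these reach every later position.
module Submission where

open import Defs
open import Data.Nat using (ℕ; _≤_; _≥_; zero; suc; _+_; _*_; _∸_; _⊔_; _<_; _<?_; pred; NonZero; >-nonZero)
open import Data.Nat.Properties
open import Data.Nat.DivMod using (_%_; _/_; m%n<n; [m+n]%n≡m%n; m≡m%n+[m/n]*n)
open import Data.Fin.Properties using (fromℕ<-cong)
open import Data.List using (length; lookup)
open import Data.Product using (_,_)
open import Relation.Nullary using (yes; no; contradiction)
open import Relation.Binary.PropositionalEquality

module _ {P : Set} where

  infixl 25 _↓_
  _↓_ : Trace P → ℕ → Trace P
  (π ↓ t) i = π (t + i)

  ≈ᵗ-sym : {π π' : Trace P} → π ≈ᵗ π' → π' ≈ᵗ π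
  ≈ᵗ-sym eq t p = sym (eq t p)

  ↓-shift : ∀ {π π' t u} → π ↓ t ≈ᵗ π' ↓ u → ∀ i → π ↓ (t + i) ≈ᵗ π' ↓ (u + i)
  ↓-shift {π} {π'} {t} {u} eq i j p = begin
    π (t + i + j) p    ≡⟨ cong (λ x → π x p) (+-assoc t i j) ⟩
    π (t + (i + j)) p  ≡⟨ eq (i + j) p ⟩
    π' (u + (i + j)) p ≡⟨ cong (λ x → π' x p) (+-assoc u i j) ⟨
    π' (u + i + j) p   ∎
    where open ≡-Reasoning

  ⊨-resp-↓ : ∀ φ {π π' t u} → π ↓ t ≈ᵗ π' ↓ u → π , t ⊨ φ → π' , u ⊨ φ
  ⊨-resp-↓ (atom p) {π} {π'} {t} {u} eq h = begin
    π' u p       ≡⟨ cong (λ x → π' x p) (+-identityʳ u) ⟨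
    π' (u + 0) p ≡⟨ eq 0 p ⟨
    π (t + 0) p  ≡⟨ cong (λ x → π x p) (+-identityʳ t) ⟩
    π t p        ≡⟨ h ⟩
    _            ∎
    where open ≡-Reasoning
  ⊨-resp-↓ ⊤ᶠ eq h = h
  ⊨-resp-↓ (¬ᶠ φ) eq h h' = h (⊨-resp-↓ φ (≈ᵗ-sym eq) h')
  ⊨-resp-↓ (φ ∧ᶠ ψ) eq (h₁ , h₂) = ⊨-resp-↓ φ eq h₁ , ⊨-resp-↓ ψ eq h₂
  ⊨-resp-↓ (φ 𝒰⟨ I ⟩ ψ) {π} {π'} {t} {u} eq (i , i∈I , hψ , hφ) =
    i , i∈I , ⊨-resp-↓ ψ (shift i) hψ ,
    λ j j<i j∈I → ⊨-resp-↓ φ (shift j) (hφ j j<i j∈I)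
    where
    shift : ∀ i → π ↓ (t + i) ≈ᵗ π' ↓ (u + i)
    shift = ↓-shift {π} {π'} {t} {u} eq
  ⊨-resp-↓ (φ ℛ⟨ I ⟩ ψ) {π} {π'} {t} {u} eq h (i , i∈I , ¬hψ , ¬hφ) =
    h (i , i∈I , (λ hψ → ¬hψ (⊨-resp-↓ ψ (shift i) hψ)) ,
       λ j j<i j∈I hφ → ¬hφ j j<i j∈I (⊨-resp-↓ φ (shift j) hφ))
    where
    shift : ∀ i → π ↓ (t + i) ≈ᵗ π' ↓ (u + i)
    shift = ↓-shift {π} {π'} {t} {u} eq

  PeriodicFrom : ℕ → ℕ → Trace P → Set
  PeriodicFrom n s π = ∀ m → n ≤ m → ∀ p → π (m + s) p ≡ π m p

  periodicFrom-resp-≈ᵗ : ∀ {n s π π'} → π ≈ᵗ π' → PeriodicFrom n s π → PeriodicFrom n s π'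
  periodicFrom-resp-≈ᵗ eq per m n≤m p =
    trans (sym (eq _ p)) (trans (per m n≤m p) (eq m p))

  periodicFrom⇒↓-period : ∀ {n s π t} → PeriodicFrom n s π → n ≤ t → π ↓ t ≈ᵗ π ↓ (t + s)
  periodicFrom⇒↓-period {n} {s} {π} {t} per n≤t i p = begin
    π (t + i) p       ≡⟨ per (t + i) (≤-trans n≤t (m≤m+n t i)) p ⟨
    π (t + i + s) p   ≡⟨ cong (λ x → π x p) (+-comm (t + i) s) ⟩
    π (s + (t + i)) p ≡⟨ cong (λ x → π x p) (+-assoc s t i) ⟨
    π (s + t + i) p   ≡⟨ cong (λ x → π (x + i) p) (+-comm s t) ⟩
    π (t + s + i) p   ∎
    where open ≡-Reasoning

  ⊨-periodicFrom : ∀ φ {n s π t} → PeriodicFrom n s π → n ≤ t → π , t ⊨ φ → π , t + s ⊨ φ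
  ⊨-periodicFrom φ per n≤t = ⊨-resp-↓ φ (periodicFrom⇒↓-period per n≤t)

  ⟦⟧-periodicFrom : (L : Lasso P) → PeriodicFrom (length (pre L)) (length (suf L)) ⟦ L ⟧
  ⟦⟧-periodicFrom L m n≤m p with m + length (suf L) <? length (pre L) | m <? length (pre L)
  ... | yes m+s<n | _ = contradiction (≤-trans n≤m (m≤m+n m _)) (<⇒≱ m+s<n)
  ... | no _ | yes m<n = contradiction n≤m (<⇒≱ m<n)
  ... | no _ | no _ = cong (λ i → lookup (suf L) i p) (fromℕ<-cong _ _ same-residue _ _)
    where
    instance
      suf-nonZero : NonZero (length (suf L))
      suf-nonZero = >-nonZero (suf-nonempty L)
    same-residue : (m + length (suf L) ∸ length (pre L)) % length (suf L)
                 ≡ (m ∸ length (pre L)) % length (suf L)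
    same-residue = trans (cong (_% length (suf L)) (+-∸-comm (length (suf L)) n≤m))
                         ([m+n]%n≡m%n (m ∸ length (pre L)) (length (suf L)))

module _ {Q : ℕ → Set} {b s : ℕ} .{{_ : NonZero s}}
         (step : ∀ t → b ≤ t → Q t → Q (t + s))
         (window : ∀ r → r < s → Q (b + r)) where

  iterate-step : ∀ k {t} → b ≤ t → Q t → Q (t + k * s)
  iterate-step zero {t} _ q = subst Q (sym (+-identityʳ t)) q
  iterate-step (suc k) {t} b≤t q =
    subst Q (+-assoc t s (k * s))
      (iterate-step k (≤-trans b≤t (m≤m+n t s)) (step t b≤t q))

  from-window : ∀ t → b ≤ t → Q t
  from-window t b≤t =
    subst Q decomposition
      (iterate-step (d / s) (m≤m+n b (d % s)) (window (d % s) (m%n<n d s)))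
    where
    d : ℕ
    d = t ∸ b
    decomposition : b + d % s + (d / s) * s ≡ t
    decomposition = begin
      b + d % s + (d / s) * s   ≡⟨ +-assoc b (d % s) _ ⟩
      b + (d % s + (d / s) * s) ≡⟨ cong (b +_) (m≡m%n+[m/n]*n d s) ⟨
      b + d                     ≡⟨ m+[n∸m]≡n b≤t ⟩
      t                         ∎
      where open ≡-Reasoning

module _ {P : Set} (L : Lasso P) where

  window≤end : ∀ a r → r < length (suf L) → a ⊔ length (pre L) + r ≤ end L a
  window≤end a r r<s with a <? length (pre L)
  ... | yes a<n = begin
    a ⊔ length (pre L) + r ≡⟨ cong (_+ r) (m≤n⇒m⊔n≡n (<⇒≤ a<n)) ⟩
    length (pre L) + r     ≤⟨ +-monoʳ-≤ (length (pre L)) (<⇒≤ r<s) ⟩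
    ∣ L ∣ˡ                 ∎
    where open ≤-Reasoning
  ... | no a≮n = begin
    a ⊔ length (pre L) + r       ≡⟨ cong (_+ r) (m≥n⇒m⊔n≡m (≮⇒≥ a≮n)) ⟩
    a + r                        ≤⟨ +-monoʳ-≤ a (<⇒≤pred r<s) ⟩
    a + pred (length (suf L))    ≡⟨ cong (a +_) (pred[m∸n]≡m∸[1+n] (length (suf L)) 0) ⟩
    a + (length (suf L) ∸ 1)     ≡⟨ +-∸-assoc a (suf-nonempty L) ⟨
    a + length (suf L) ∸ 1       ∎
    where open ≤-Reasoning

  ≤end-before-window : ∀ {a t} → a ≤ t → t < a ⊔ length (pre L) → t ≤ end L a
  ≤end-before-window {a} {t} a≤t t<a⊔n with a <? length (pre L)
  ... | yes a<n = ≤-trans (<⇒≤ (subst (t <_) (m≤n⇒m⊔n≡n (<⇒≤ a<n)) t<a⊔n))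
                          (m≤m+n (length (pre L)) _)
  ... | no a≮n = contradiction (subst (t <_) (m≥n⇒m⊔n≡m (≮⇒≥ a≮n)) t<a⊔n) (≤⇒≯ a≤t)

lemma5 : {P : Set} (φ : MTL P) (π : Trace P) (L : Lasso P) → MinimalLassoOf π L →
    (a : ℕ) → ((t : ℕ) → a ≤ t → t ≤ end L a → π , t ⊨ φ) →
    (t' : ℕ) → t' ≥ a → π , t' ⊨ φ
lemma5 φ π L M a H t' a≤t' with t' <? a ⊔ length (pre L)
... | yes t'<b = H t' a≤t' (≤end-before-window L a≤t' t'<b)
... | no t'≮b = from-window step window t' (≮⇒≥ t'≮b)
  where
  instance
    suf-nonZero : NonZero (length (suf L))
    suf-nonZero = >-nonZero (suf-nonempty L)
  b : ℕ
  b = a ⊔ length (pre L)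
  per : PeriodicFrom (length (pre L)) (length (suf L)) π
  per = periodicFrom-resp-≈ᵗ (MinimalLassoOf.presents M) (⟦⟧-periodicFrom L)
  step : ∀ t → b ≤ t → π , t ⊨ φ → π , t + length (suf L) ⊨ φ
  step t b≤t = ⊨-periodicFrom φ per (≤-trans (m≤n⊔m a _) b≤t)
  window : ∀ r → r < length (suf L) → π , b + r ⊨ φ
  window r r<s = H (b + r) (≤-trans (m≤m⊔n a _) (m≤m+n b r)) (window≤end L a r r<s)
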